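{- Let $s$ be the statement $\mathsf{while}\ \mathsf{true}\ \mathsf{do}\ (y:=x;\ (\mathsf{while}\ y\neq 0\ \mathsf{do}\ y:=y-1);\ x:=x+1)$. Then $\{x=0\}\,s\,\{\mathit{up}\ 0\}$ is derivable in the trace-based Hoare logic.
   Context: While statements: $s ::= x:=e \mid \mathsf{skip}\mid s_0;s_1\mid \mathsf{if}\ e\ \mathsf{then}\ s_t\ \mathsf{else}\ s_f\mid \mathsf{while}\ e\ \mathsf{do}\ s_t$; a state $\sigma$ assigns integers to variables ($\sigma\,x$ is the value of $x$), $[\![e]\!]\sigma$ is the value of $e$, $\sigma\models e$ means $e$ is true in $\sigma$. The metatheory is constructive. Traces are coinductive: $\langle\sigma\rangle$, and $\sigma::\tau$ for a trace $\tau$; bisimilarity $\approx$ is coinductive ($\langle\sigma\rangle\approx\langle\sigma\rangle$; $\sigma::\tau\approx\sigma::\tau'$ if $\tau\approx\tau'$); $\mathit{hd}\langle\sigma\rangle=\mathit{hd}(\sigma::\tau)=\sigma$. The relation $\tau\rhd\tau'$ is inductive: $(\sigma::\tau)\rhd\tau'$ if $\sigma\,x=(\mathit{hd}\,\tau)\,x$ and $\tau\rhd\tau'$; $(\sigma::\tau)\rhd\tau'$ if $\sigma\,x\neq(\mathit{hd}\,\tau)\,x$ and $\tau\approx\tau'$. The trace predicates $\mathit{up}\ n$ ($n\in\mathbb{N}$) are coinductive: $\sigma::\tau$ satisfies $\mathit{up}\ n$ if $\sigma\,x=n$, $(\sigma::\tau)\rhd\tau'$, and $\tau'$ satisfies $\mathit{up}\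 (n+1)$. State predicates are arbitrary; trace predicates are setoid predicates (invariant under $\approx$); $\mathsf{true},\wedge,\neg,\exists$ are pointwise; $\models$ is entailment. $\langle U\rangle$ holds exactly of $\langle\sigma\rangle$ with $\sigma\models U$; $\mathrm{dup}(U)$ exactly of $\sigma::\langle\sigma\rangle$ with $\sigma\models U$; $U[x\mapsto e]$ exactly of $\sigma::\langle\sigma[x\mapsto[\![e]\!]\sigma]\rangle$ with $\sigma\models U$. $\mathrm{follows}_Q(\tau,\tau')$ is coinductive: $\mathrm{follows}_Q(\langle\sigma\rangle,\tau)$ if $\mathit{hd}\,\tau=\sigma$ and $\tau\models Q$; $\mathrm{follows}_Q(\sigma::\tau,\sigma::\tau')$ if $\mathrm{follows}_Q(\tau,\tau')$. $\tau'\models P\ast\ast Q$ iff $\exists\tau$, $\tau\models P$ and $\mathrm{follows}_Q(\tau,\tau')$ (chains associate to the right). $P^{\dagger}$ is coinductive: $\tau\models P^{\dagger}$ if $\tau\models\langle\mathsf{true}\rangle$; $\tau'\models P^{\dagger}$ if $\exists\tau$, $\tau\models P$ and $\mathrm{follows}_{P^{\dagger}}(\tau,\tau')$. The trace-based Hoare logic derives $\{U\}\,s\,\{P\}$ inductively by: $\{U\}\,x:=e\,\{U[x\mapsto e]\}$; $\{U\}\,\mathsf{skip}\,\{\langle U\rangle\}$; from $\{U\}\,s_0\,\{P\ast\ast\langle V\rangle\}$ and $\{V\}\,s_1\,\{Q\}$ infer $\{U\}\,s_0;s_1\,\{P\ast\ast Q\}$; from $\{e\wedge U\}\,s_t\,\{P\}$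 and $\{\neg e\wedge U\}\,s_f\,\{P\}$ infer $\{U\}\,\mathsf{if}\ e\ \mathsf{then}\ s_t\ \mathsf{else}\ s_f\,\{\mathrm{dup}(U)\ast\ast P\}$; from $U\models I$ and $\{e\wedge I\}\,s_t\,\{P\ast\ast\langle I\rangle\}$ infer $\{U\}\,\mathsf{while}\ e\ \mathsf{do}\ s_t\,\{\mathrm{dup}(U)\ast\ast(P\ast\ast\mathrm{dup}(I))^{\dagger}\ast\ast\langle\neg e\rangle\}$; from $U\models U'$, $\{U'\}\,s\,\{P'\}$, $P'\models P$ infer $\{U\}\,s\,\{P\}$; from $\forall z.\ \{U_z\}\,s\,\{P_z\}$ infer $\{\exists z.U_z\}\,s\,\{\exists z.P_z\}$. -}

module Defs where

open import Level using (Level; _⊔_; 0ℓ; Lift; Setω) renaming (suc to lsuc)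
open import Data.Nat using (ℕ; zero; suc) renaming (_≡ᵇ_ to _≡ℕᵇ_)
open import Data.Integer using (ℤ; +_) renaming (_+_ to _+ℤ_; _-_ to _-ℤ_)
import Data.Integer.Properties as ℤP
open import Data.Bool using (Bool; true; false; if_then_else_; T; not; _∧_)
open import Data.Maybe using (Maybe; just; nothing)
open import Data.Product using (Σ; _×_; _,_)
open import Data.Sum using (_⊎_)
open import Data.Unit using (⊤)
open import Data.Empty using (⊥)
open import Relation.Nullary using (¬_)
open import Relation.Nullary.Decidable using (⌊_⌋)
open import Relation.Binary.PropositionalEquality using (_≡_)

Var : Set
Var = ℕ

x y : Var
x = 0
y = 1

State : Set
State = Var → ℤ

_[_↦_] : State → Var → ℤ → State
(σ [ v ↦ n ]) w = if w ≡ℕᵇ v then n else σ w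

data AExp : Set where
  var : Var → AExp
  lit : ℤ → AExp
  _⊕_ : AExp → AExp → AExp
  _⊖_ : AExp → AExp → AExp

⟦_⟧ : AExp → State → ℤ
⟦ var v ⟧ σ = σ v
⟦ lit n ⟧ σ = n
⟦ a ⊕ b ⟧ σ = ⟦ a ⟧ σ +ℤ ⟦ b ⟧ σ
⟦ a ⊖ b ⟧ σ = ⟦ a ⟧ σ -ℤ ⟦ b ⟧ σ

data BExp : Set where
  btrue : BExp
  _≠_   : AExp → AExp → BExp
  _==_  : AExp → AExp → BExp
  bnot  : BExp → BExp
  _&&_  : BExp → BExp → BExp

⟦_⟧ᵇ : BExp → State → Bool
⟦ btrue ⟧ᵇ σ = true
⟦ a ≠ b ⟧ᵇ σ = not ⌊ ⟦ a ⟧ σ ℤP.≟ ⟦ b ⟧ σ ⌋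
⟦ a == b ⟧ᵇ σ = ⌊ ⟦ a ⟧ σ ℤP.≟ ⟦ b ⟧ σ ⌋
⟦ bnot b ⟧ᵇ σ = not (⟦ b ⟧ᵇ σ)
⟦ b && c ⟧ᵇ σ = ⟦ b ⟧ᵇ σ ∧ ⟦ c ⟧ᵇ σ

_⊨_ : State → BExp → Set
σ ⊨ e = T (⟦ e ⟧ᵇ σ)

data Stmt : Set where
  _≔_       : Var → AExp → Stmt
  skip      : Stmt
  _︔_       : Stmt → Stmt → Stmt
  IF_THEN_ELSE_ : BExp → Stmt → Stmt → Stmt
  while_loop_ : BExp → Stmt → Stmt

SPred : Set₁
SPred = State → Set

_∧ˢ_ : BExp → SPred → SPred
(e ∧ˢ U) σ = σ ⊨ e × U σ

_¬∧ˢ_ : BExp → SPred → SPred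
(e ¬∧ˢ U) σ = ¬ (σ ⊨ e) × U σ

⌜_⌝ : BExp → SPred
⌜ e ⌝ σ = σ ⊨ e

⌜¬_⌝ : BExp → SPred
⌜¬ e ⌝ σ = ¬ (σ ⊨ e)

_⊨ˢ_ : SPred → SPred → Set
U ⊨ˢ V = ∀ σ → U σ → V σ

-- Traces: possibly infinite non-empty sequences of states.
-- Agda's --safe mode (without --guardedness) has no coinductive types, so
-- a trace is encoded as its head state together with the (partial) sequence
-- of the remaining states, whose domain of definition is downward closed.

record Trace : Set where
  constructor mkTrace
  field
    hd     : State
    rest   : ℕ → Maybe State
    closed : ∀ n → rest n ≡ nothing → rest (suc n) ≡ nothing
open Trace public

⟨_⟩ : State → Trace
⟨ σ ⟩ = mkTrace σ (λ _ → nothing) (λ _ _ → Relation.Binary.PropositionalEquality.refl)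

_∷_ : State → Trace → Trace
σ ∷ τ = mkTrace σ r c
  where
  r : ℕ → Maybe State
  r zero = just (hd τ)
  r (suc n) = rest τ n
  c : ∀ n → r n ≡ nothing → r (suc n) ≡ nothing
  c zero ()
  c (suc n) e = closed τ n e

data Step : Set where
  end  : State → Step
  cons : State → Trace → Step

step : State → Maybe State → (State → Trace) → Step
step h nothing  f = end h
step h (just s) f = cons h (f s)

out : Trace → Step
out (mkTrace h r c) = step h (r 0) (λ s → mkTrace s (λ n → r (suc n)) (λ n → c (suc n)))

-- Coinductive definitions are encoded as greatest fixed points:
-- membership means membership in some post-fixed point.

BisimS : (Trace → Trace → Set) → Step → Step → Set
BisimS R (end σ)    (end σ')     = σ ≡ σ'
BisimS R (cons σ t) (cons σ' t') = σ ≡ σ' × R t t'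
BisimS R _          _            = ⊥

_≈_ : Trace → Trace → Set₁
τ ≈ τ' = Σ (Trace → Trace → Set) λ R →
           (∀ a b → R a b → BisimS R (out a) (out b)) × R τ τ'

TPred : (ℓ : Level) → Set (lsuc ℓ)
TPred ℓ = Trace → Set ℓ

IsSetoid : ∀ {ℓ} → TPred ℓ → Set (lsuc 0ℓ ⊔ ℓ)
IsSetoid P = ∀ {τ τ'} → τ ≈ τ' → P τ → P τ'

_⊨ᵗ_ : ∀ {a b} → TPred a → TPred b → Set (a ⊔ b)
P ⊨ᵗ Q = ∀ τ → P τ → Q τ

∃ᵗ : ∀ {ℓ} {Z : Set} → (Z → TPred ℓ) → TPred ℓ
∃ᵗ {Z = Z} P τ = Σ Z λ z → P z τ

∃ˢ : {Z : Set} → (Z → SPred) → SPred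
∃ˢ {Z = Z} U σ = Σ Z λ z → U z σ

RetS : SPred → Step → Set
RetS U (end σ)    = U σ
RetS U (cons _ _) = ⊥

Ret : SPred → TPred 0ℓ
Ret U τ = RetS U (out τ)

IsEnd : State → Step → Set
IsEnd σ (end σ')   = σ' ≡ σ
IsEnd σ (cons _ _) = ⊥

DupS : SPred → Step → Set
DupS U (end _)    = ⊥
DupS U (cons σ t) = U σ × IsEnd σ (out t)

Dup : SPred → TPred 0ℓ
Dup U τ = DupS U (out τ)

AssignS : SPred → Var → AExp → Step → Set
AssignS U v e (end _)    = ⊥
AssignS U v e (cons σ t) = U σ × IsEnd (σ [ v ↦ ⟦ e ⟧ σ ]) (out t)

Assign : SPred → Var → AExp → TPred 0ℓ
Assign U v e τ = AssignS U v e (out τ)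

FollowsS : ∀ {b} → TPred b → (Trace → Trace → Set b) → Step → Trace → Set b
FollowsS Q R (end σ)    τ' = hd τ' ≡ σ × Q τ'
FollowsS {b} Q R (cons σ t) τ' = FC (out τ')
  where
  FC : Step → Set b
  FC (end _)      = Lift b ⊥
  FC (cons σ' t') = σ' ≡ σ × R t t'

Follows : ∀ {b} → TPred b → Trace → Trace → Set (lsuc b)
Follows {b} Q τ τ' = Σ (Trace → Trace → Set b) λ R →
  (∀ a c → R a c → FollowsS Q R (out a) c) × R τ τ'

infixr 5 _**_
_**_ : ∀ {a b} → TPred a → TPred b → TPred (a ⊔ lsuc b)
(P ** Q) τ' = Σ Trace λ τ → P τ × Follows Q τ τ'

DaggerF : ∀ {a} → TPred a → TPred a → TPred (lsuc a)
DaggerF P D τ' = Ret (λ _ → ⊤) τ' ⊎ (Σ Trace λ τ → P τ × Follows D τ τ')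

_† : ∀ {a} → TPred a → TPred (lsuc a)
(_† {a} P) τ = Σ (TPred a) λ D → (∀ t → D t → DaggerF P D t) × D τ

data _▷ₛ_ : Step → Trace → Set₁ where
  same : ∀ {σ t τ'} → σ x ≡ hd t x → out t ▷ₛ τ' → cons σ t ▷ₛ τ'
  diff : ∀ {σ t τ'} → ¬ (σ x ≡ hd t x) → t ≈ τ' → cons σ t ▷ₛ τ'

_▷_ : Trace → Trace → Set₁
τ ▷ τ' = out τ ▷ₛ τ'

UpS : (ℕ → Trace → Set₁) → ℕ → Step → Set₁
UpS R n (end _)    = Lift _ ⊥
UpS R n (cons σ t) = σ x ≡ + n × Σ Trace λ τ' → (cons σ t ▷ₛ τ') × R (suc n) τ'

up : ℕ → TPred (lsuc (lsuc 0ℓ))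
up n τ = Σ (ℕ → Trace → Set₁) λ R → (∀ m t → R m t → UpS R m (out t)) × R n τ

data ⊢⟦_⟧_⟦_⟧ : SPred → Stmt → {ℓ : Level} → TPred ℓ → Setω where
  assign-rule : ∀ {U v e} → ⊢⟦ U ⟧ v ≔ e ⟦ Assign U v e ⟧
  skip-rule : ∀ {U} → ⊢⟦ U ⟧ skip ⟦ Ret U ⟧
  seq-rule : ∀ {a b U V s₀ s₁} {P : TPred a} {Q : TPred b} →
           IsSetoid P → IsSetoid Q →
           ⊢⟦ U ⟧ s₀ ⟦ P ** Ret V ⟧ → ⊢⟦ V ⟧ s₁ ⟦ Q ⟧ →
           ⊢⟦ U ⟧ s₀ ︔ s₁ ⟦ P ** Q ⟧
  if-rule : ∀ {a U e st sf} {P : TPred a} →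
           IsSetoid P →
           ⊢⟦ e ∧ˢ U ⟧ st ⟦ P ⟧ → ⊢⟦ e ¬∧ˢ U ⟧ sf ⟦ P ⟧ →
           ⊢⟦ U ⟧ IF e THEN st ELSE sf ⟦ Dup U ** P ⟧
  while-rule : ∀ {a U I e st} {P : TPred a} →
           IsSetoid P →
           U ⊨ˢ I → ⊢⟦ e ∧ˢ I ⟧ st ⟦ P ** Ret I ⟧ →
           ⊢⟦ U ⟧ while e loop st ⟦ Dup U ** ((P ** Dup I) † ** Ret ⌜¬ e ⌝) ⟧
  conseq-rule : ∀ {a a' U U' s} {P : TPred a} {P' : TPred a'} →
           IsSetoid P → IsSetoid P' →
           U ⊨ˢ U' → ⊢⟦ U' ⟧ s ⟦ P' ⟧ → P' ⊨ᵗ P →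
           ⊢⟦ U ⟧ s ⟦ P ⟧
  exists-rule : ∀ {a s} {Z : Set} {U : Z → SPred} {P : Z → TPred a} →
           (∀ z → IsSetoid (P z)) →
           (∀ z → ⊢⟦ U z ⟧ s ⟦ P z ⟧) →
           ⊢⟦ ∃ˢ U ⟧ s ⟦ ∃ᵗ P ⟧

prog : Stmt
prog = while btrue loop
         ((y ≔ var x) ︔ ((while (var y ≠ lit (+ 0)) loop (y ≔ (var y ⊖ lit (+ 1)))) ︔ (x ≔ (var x ⊕ lit (+ 1)))))

x≡0 : SPred
x≡0 σ = σ x ≡ + 0

module Submission where

-- The outer loop of
--   s = while true do (y := x; (while y ≠ 0 do y := y - 1); x := x + 1)
-- is derived with invariant "x is a natural number"; its body is derived,
-- for each value n of x, with the inner loop's invariant "x = n".  The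
-- work is in the consequence steps, which read the while-rule
-- postconditions  dup(U) ** (P ** dup(I))† ** ⟨¬e⟩  back as concrete traces:
--   * the inner loop terminates, by induction on the value of y, so one
--     outer iteration with x = n produces a finite block of states with
--     x = n ending in a state with x = n + 1 (the predicate FinX);
--   * a trace following such a block reaches, through ▷, the rest of the
--     trace after the block (lemma crossing);
--   * the states between outer iterations ("seams") therefore form a
--     post-fixed point of the coinductive predicate up (lemma up-coind).

open import Defs
open import Level using (_⊔_; 0ℓ; lower) renaming (suc to lsuc)
open import Data.Nat using (ℕ; zero; suc)
import Data.Nat.Properties as ℕP
open import Data.Integer using (ℤ; +_) renaming (_+_ to _+ℤ_; _-_ to _-ℤ_)
import Data.Integer.Properties as ℤP
open import Data.Bool using (T; not)
open import Data.Maybe using (just; nothing)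
open import Data.Product using (Σ; _×_; _,_; proj₁; proj₂)
open import Data.Sum using (_⊎_; inj₁; inj₂)
open import Data.Unit using (tt)
open import Data.Empty using (⊥-elim)
open import Relation.Nullary using (¬_)
open import Relation.Nullary.Decidable using (⌊_⌋)
open import Relation.Binary.PropositionalEquality using (_≡_; refl; sym; trans; cong; subst)

xOf : State → ℤ
xOf σ = σ x

hdS : Step → State
hdS (end σ) = σ
hdS (cons σ _) = σ

hd-out : ∀ τ → hdS (out τ) ≡ hd τ
hd-out (mkTrace h r c) with r 0
... | nothing = refl
... | just s = refl

out-end-hd : ∀ τ {σ} → out τ ≡ end σ → hd τ ≡ σ
out-end-hd τ eq = trans (sym (hd-out τ)) (cong hdS eq)

out-cons-hd : ∀ τ {σ t} → out τ ≡ cons σ t → hd τ ≡ σ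
out-cons-hd τ eq = trans (sym (hd-out τ)) (cong hdS eq)

≈-refl : ∀ {τ} → τ ≈ τ
≈-refl = _≡_ , diagonal , refl
  where
  reflS : ∀ s → BisimS _≡_ s s
  reflS (end σ) = refl
  reflS (cons σ t) = refl , refl
  diagonal : ∀ a b → a ≡ b → BisimS _≡_ (out a) (out b)
  diagonal a .a refl = reflS (out a)

≈-sym : ∀ {a b} → a ≈ b → b ≈ a
≈-sym (R , post , r) = (λ a b → R b a) , (λ a b r' → flipS (out b) (out a) (post b a r')) , r
  where
  flipS : ∀ s s' → BisimS R s s' → BisimS (λ a b → R b a) s' s
  flipS (end σ) (end σ') e = sym e
  flipS (end _) (cons _ _) ()
  flipS (cons _ _) (end _) ()
  flipS (cons σ t) (cons σ' t') (e , r) = sym e , r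

≈-trans : ∀ {a b c} → a ≈ b → b ≈ c → a ≈ c
≈-trans (R₁ , post₁ , r₁) (R₂ , post₂ , r₂) = R , post , (_ , r₁ , r₂)
  where
  R : Trace → Trace → Set
  R a c = Σ Trace λ b → R₁ a b × R₂ b c
  compose : ∀ s₁ s₂ s₃ → BisimS R₁ s₁ s₂ → BisimS R₂ s₂ s₃ → BisimS R s₁ s₃
  compose (end _) (end _) (end _) e₁ e₂ = trans e₁ e₂
  compose (cons _ _) (cons _ t₂) (cons _ _) (e₁ , q₁) (e₂ , q₂) = trans e₁ e₂ , (t₂ , q₁ , q₂)
  compose (end _) (end _) (cons _ _) _ ()
  compose (end _) (cons _ _) _ () _
  compose (cons _ _) (end _) _ () _
  compose (cons _ _) (cons _ _) (end _) _ ()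
  post : ∀ a c → R a c → BisimS R (out a) (out c)
  post a c (b , p , q) = compose (out a) (out b) (out c) (post₁ a b p) (post₂ b c q)

bisimS-end : ∀ {R : Trace → Trace → Set} {σ} s' → BisimS R (end σ) s' → s' ≡ end σ
bisimS-end (end σ') e = cong end (sym e)
bisimS-end (cons _ _) ()

bisimS-cons : ∀ {R : Trace → Trace → Set} {σ t} s' → BisimS R (cons σ t) s' →
              Σ Trace λ t' → s' ≡ cons σ t' × R t t'
bisimS-cons (end _) ()
bisimS-cons (cons σ' t') (e , r) = t' , cong (λ z → cons z t') (sym e) , r

≈-end : ∀ {a b σ} → a ≈ b → out a ≡ end σ → out b ≡ end σ
≈-end {a} {b} (R , post , r) eq = bisimS-end (out b) (subst (λ s → BisimS R s (out b)) eq (post a b r))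

≈-cons : ∀ {a b σ t} → a ≈ b → out a ≡ cons σ t → Σ Trace λ t' → out b ≡ cons σ t' × t ≈ t'
≈-cons {a} {b} (R , post , r) eq with bisimS-cons (out b) (subst (λ s → BisimS R s (out b)) eq (post a b r))
... | t' , e , r' = t' , e , (R , post , r')

≈-hd : ∀ {a b} → a ≈ b → hd a ≡ hd b
≈-hd {a} {b} p with out a in eq
... | end σ = trans (out-end-hd a eq) (sym (out-end-hd b (≈-end {a} {b} p eq)))
... | cons σ t = trans (out-cons-hd a eq) (sym (out-cons-hd b (proj₁ (proj₂ (≈-cons {a} {b} p eq)))))

module _ {b} {Q : TPred b} where
  followsS-cons : ∀ {R σ a'} c → FollowsS Q R (cons σ a') c →
                  Σ Trace λ c' → out c ≡ cons σ c' × R a' c'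
  followsS-cons c f with out c in e
  ... | end _ = ⊥-elim (lower f)
  ... | cons σ' c' = c' , cong (λ z → cons z c') (proj₁ f) , proj₂ f

  followsS-cons⁻¹ : ∀ {R σ a'} c {c'} → out c ≡ cons σ c' → R a' c' → FollowsS Q R (cons σ a') c
  followsS-cons⁻¹ c e r rewrite e = refl , r

  follows-end : ∀ {a c σ} → Follows Q a c → out a ≡ end σ → hd c ≡ σ × Q c
  follows-end {a} {c} (R , post , r) eq = subst (λ s → FollowsS Q R s c) eq (post a c r)

  follows-cons : ∀ {a c σ a'} → Follows Q a c → out a ≡ cons σ a' →
                 Σ Trace λ c' → out c ≡ cons σ c' × Follows Q a' c'
  follows-cons {a} {c} (R , post , r) eq with followsS-cons c (subst (λ s → FollowsS Q R s c) eq (post a c r))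
  ... | c' , e , r' = c' , e , (R , post , r')

  follows-hd : ∀ {a c} → Follows Q a c → hd c ≡ hd a
  follows-hd {a} {c} f with out a in eq
  ... | end σ = trans (proj₁ (follows-end {a} {c} f eq)) (sym (out-end-hd a eq))
  ... | cons σ a' = trans (out-cons-hd c (proj₁ (proj₂ (follows-cons {a} {c} f eq)))) (sym (out-cons-hd a eq))

  follows-≈ : IsSetoid Q → ∀ {a c c'} → Follows Q a c → c ≈ c' → Follows Q a c'
  follows-≈ setoidQ (R , post , r) (R₀ , post₀ , r₀) = R' , post' , (_ , r , r₀)
    where
    R' : Trace → Trace → Set b
    R' a c = Σ Trace λ b → R a b × R₀ b c
    post' : ∀ a c → R' a c → FollowsS Q R' (out a) c
    post' a c (b , p , q) with out a in eq
    ... | end σ = trans (sym (≈-hd {b} {c} (R₀ , post₀ , q))) (proj₁ fe) , setoidQ {b} {c} (R₀ , post₀ , q) (proj₂ fe)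
      where
      fe : FollowsS Q R (end σ) b
      fe = subst (λ s → FollowsS Q R s b) eq (post a b p)
    ... | cons σ a' with followsS-cons b (subst (λ s → FollowsS Q R s b) eq (post a b p))
    ...   | b' , eb , rb with bisimS-cons (out c) (subst (λ s → BisimS R₀ s (out c)) eb (post₀ b c q))
    ...     | c' , ec , rc = followsS-cons⁻¹ c ec (b' , rb , rc)

follows-assoc : ∀ {q d} {Q : TPred q} {D : TPred d} {a b c} →
                Follows Q a b → Follows D b c → Follows (Q ** D) a c
follows-assoc {q} {d} {Q} {D} (Rq , postq , rq) fd = R , post , (_ , rq , fd)
  where
  R : Trace → Trace → Set (q ⊔ lsuc d)
  R a c = Σ Trace λ b → Rq a b × Follows D b c
  post : ∀ a c → R a c → FollowsS (Q ** D) R (out a) c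
  post a c (b , p , f) with out a in eq
  ... | end σ = trans (follows-hd {a = b} {c = c} f) (proj₁ fe) , (b , proj₂ fe , f)
    where
    fe : FollowsS Q Rq (end σ) b
    fe = subst (λ s → FollowsS Q Rq s b) eq (postq a b p)
  ... | cons σ a' with followsS-cons {Q = Q} b (subst (λ s → FollowsS Q Rq s b) eq (postq a b p))
  ...   | b' , eb , rb with follows-cons {a = b} {c = c} f eb
  ...     | c' , ec , fc = followsS-cons⁻¹ {Q = Q ** D} c ec (b' , rb , fc)

isEnd-inv : ∀ t σ → IsEnd σ (out t) → out t ≡ end σ
isEnd-inv t σ ie with out t
... | end σ' = cong end ie
... | cons _ _ = ⊥-elim ie

ret-inv : ∀ {U} τ → Ret U τ → Σ State λ σ → out τ ≡ end σ × U σ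
ret-inv τ r with out τ
... | end σ = σ , refl , r
... | cons _ _ = ⊥-elim r

dup-inv : ∀ {U} τ → Dup U τ → Σ State λ σ → Σ Trace λ t → out τ ≡ cons σ t × out t ≡ end σ × U σ
dup-inv τ d with out τ
... | end _ = ⊥-elim d
... | cons σ t = σ , t , refl , isEnd-inv t σ (proj₂ d) , proj₁ d

assign-inv : ∀ {U v e} τ → Assign U v e τ →
  Σ State λ σ → Σ Trace λ t → out τ ≡ cons σ t × out t ≡ end (σ [ v ↦ ⟦ e ⟧ σ ]) × U σ
assign-inv τ d with out τ
... | end _ = ⊥-elim d
... | cons σ t = σ , t , refl , isEnd-inv t _ (proj₂ d) , proj₁ d

ret-setoid : ∀ {U} → IsSetoid (Ret U)
ret-setoid {U} {τ} {τ'} p r with ret-inv τ r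
... | σ , e , u = subst (RetS U) (sym (≈-end {τ} {τ'} p e)) u

assign-setoid : ∀ {U v e} → IsSetoid (Assign U v e)
assign-setoid {U} {v} {e} {τ} {τ'} p d with assign-inv τ d
... | σ , t , e₁ , e₂ , u with ≈-cons {τ} {τ'} p e₁
...   | t' , e₁' , q = subst (AssignS U v e) (sym e₁') (u , subst (IsEnd _) (sym (≈-end {t} {t'} q e₂)) refl)

**-setoid : ∀ {a b} {P : TPred a} {Q : TPred b} → IsSetoid Q → IsSetoid (P ** Q)
**-setoid setoidQ p (τ₀ , pτ₀ , f) = τ₀ , pτ₀ , follows-≈ setoidQ f p

∃-setoid : ∀ {a} {Z : Set} {P : Z → TPred a} → (∀ z → IsSetoid (P z)) → IsSetoid (∃ᵗ P)
∃-setoid setoidP p (z , q) = z , setoidP z p q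

dagger-witness : ∀ {a q} {P : TPred a} {Q : TPred q} {τ} → ((P †) ** Q) τ →
                 Σ (TPred a) λ D → (∀ t → D t → DaggerF P D t) × (D ** Q) τ
dagger-witness (t , (D , unroll , d) , f) = D , unroll , (t , d , f)

loop-unfold : ∀ {a q} {P : TPred a} {I : SPred} {Q : TPred q} {D : TPred (a ⊔ lsuc 0ℓ)} →
              (∀ t → D t → DaggerF (P ** Dup I) D t) →
              ∀ u → (D ** Q) u → Q u ⊎ (P ** (Dup I ** (D ** Q))) u
loop-unfold unroll u (w , dw , fw) with unroll w dw
... | inj₁ r with ret-inv w r
...   | _ , e , _ = inj₁ (proj₂ (follows-end fw e))
loop-unfold unroll u (w , dw , fw) | inj₂ (τ , (τp , p , fp) , fd) =
  inj₂ (τp , p , follows-assoc fp (follows-assoc fd fw))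

dup-head : ∀ {q} {U : SPred} {Q : TPred q} w → (Dup U ** Q) w →
           Σ Trace λ w' → out w ≡ cons (hd w') w' × U (hd w') × Q w'
dup-head {U = U} w (d , dd , f) with dup-inv d dd
... | σ , d₁ , e₁ , e₂ , u with follows-cons f e₁
... | w' , ew , f₁ with follows-end f₁ e₂
... | hw' , qw' = w' , subst (λ s → out w ≡ cons s w') (sym hw') ew , subst U (sym hw') u , qw'

-- ▷ only looks at the states of its left argument, so it respects ≈ there.
▷-resp-≈ : ∀ {s τ''} → s ▷ₛ τ'' → ∀ {t t'} → out t ≡ s → t ≈ t' → out t' ▷ₛ τ''
▷-resp-≈ (same {σ} {t₁} p q) {t} {t'} e r with ≈-cons {t} {t'} r e
... | t₁' , e' , q₁ =
  subst (_▷ₛ _) (sym e') (same (trans p (cong xOf (≈-hd {t₁} {t₁'} q₁))) (▷-resp-≈ q {t₁} {t₁'} refl q₁))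
▷-resp-≈ (diff {σ} {t₁} p q) {t} {t'} e r with ≈-cons {t} {t'} r e
... | t₁' , e' , q₁ =
  subst (_▷ₛ _) (sym e') (diff (λ e₁ → p (trans e₁ (cong xOf (sym (≈-hd {t₁} {t₁'} q₁)))))
                               (≈-trans {t₁'} {t₁} (≈-sym {t₁} {t₁'} q₁) q))

up-setoid : ∀ {n} → IsSetoid (up n)
up-setoid {n} {τ} {τ'} p (R , post , r) = R' , post' , (τ , r , p)
  where
  R' : ℕ → Trace → Set₁
  R' m t = Σ Trace λ t₀ → R m t₀ × t₀ ≈ t
  post' : ∀ m t → R' m t → UpS R' m (out t)
  post' m t (t₀ , r₀ , q) with post m t₀ r₀
  ... | u with out t₀ in eq
  ...   | end _ = ⊥-elim (lower u)
  ...   | cons σ t₁ with u | ≈-cons {t₀} {t} q eq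
  ...     | hx , τ'' , cross , r'' | t₁' , e' , q₁ =
    subst (UpS R' m) (sym e') (hx , τ'' , subst (_▷ₛ τ'') e' (▷-resp-≈ cross {t₀} {t} eq q) , (τ'' , r'' , ≈-refl))

up-coind : (R : ℕ → Trace → Set₁) →
           (∀ m t → R m t → hd t x ≡ + m × Σ Trace λ τ → (out t ▷ₛ τ) × R (suc m) τ) →
           ∀ {n t} → R n t → up n t
up-coind R advance r = R , post , r
  where
  unfoldUp : ∀ {m s τ} → hdS s x ≡ + m → s ▷ₛ τ → R (suc m) τ → UpS R m s
  unfoldUp h (same p q) r = h , _ , same p q , r
  unfoldUp h (diff p q) r = h , _ , diff p q , r
  post : ∀ m t → R m t → UpS R m (out t)
  post m t r with advance m t r
  ... | hx , τ , cross , r' = unfoldUp (trans (cong xOf (hd-out t)) hx) cross r'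

data FinX (c : ℤ) (E : State → Set) : Trace → Set where
  fend  : ∀ {τ σ} → out τ ≡ end σ → E σ → FinX c E τ
  fcons : ∀ {τ σ t} → out τ ≡ cons σ t → σ x ≡ c → FinX c E t → FinX c E τ

finx-setoid : ∀ {c E} → IsSetoid (FinX c E)
finx-setoid {τ = τ} {τ'} p (fend e u) = fend (≈-end {τ} {τ'} p e) u
finx-setoid {τ = τ} {τ'} p (fcons e h f) with ≈-cons {τ} {τ'} p e
... | t' , e' , q = fcons e' h (finx-setoid q f)

finx-ret : ∀ {c E V τ} → FinX c E τ → (∀ σ → E σ → V σ) → Follows (Ret V) τ τ
finx-ret {c} {E} {V} {τ} f h = R , post , (refl , f)
  where
  R : Trace → Trace → Set
  R a b = a ≡ b × FinX c E a
  post : ∀ a b → R a b → FollowsS (Ret V) R (out a) b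
  post a .a (refl , fend {σ = σ} e u) =
    subst (λ s → FollowsS (Ret V) R s a) (sym e) (out-end-hd a e , subst (RetS V) (sym e) (h σ u))
  post a .a (refl , fcons e hx f') =
    subst (λ s → FollowsS (Ret V) R s a) (sym e) (followsS-cons⁻¹ {Q = Ret V} a e (refl , f'))

finx-follows : ∀ {q} {Q : TPred q} {c E E' τ τ'} → FinX c E τ → Follows Q τ τ' →
               (∀ u → Q u → E (hd u) → FinX c E' u) → FinX c E' τ'
finx-follows {τ = τ} {τ'} (fend e u) f h with follows-end {a = τ} {c = τ'} f e
... | eh , qq = h τ' qq (subst _ (sym eh) u)
finx-follows {τ = τ} {τ'} (fcons e hx f') f h with follows-cons {a = τ} {c = τ'} f e
... | c' , e' , f'' = fcons e' hx (finx-follows f' f'' h)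

assign→finx : ∀ {A v e c E τ} → (∀ σ → A σ → σ x ≡ c) → (∀ σ → A σ → E (σ [ v ↦ ⟦ e ⟧ σ ])) →
              Assign A v e τ → FinX c E τ
assign→finx {τ = τ} hx he d with assign-inv τ d
... | σ , t , e₁ , e₂ , a = fcons e₁ (hx σ a) (fend e₂ (he σ a))

-- {U} v := e {U[v ↦ e] ** ⟨V⟩} when the assignment establishes V (and U
-- fixes the value of x, so that the assignment trace is a block).
assign-ret : ∀ {U V v e c} → (∀ σ → U σ → σ x ≡ c) → (∀ σ → U σ → V (σ [ v ↦ ⟦ e ⟧ σ ])) →
             Assign U v e ⊨ᵗ (Assign U v e ** Ret V)
assign-ret {V = V} fixes establish τ a = τ , a , finx-ret {E = V} (assign→finx fixes establish a) (λ σ h → h)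

crossing-from : ∀ {q} {Q : TPred q} {c E τb σ t u} → out τb ≡ cons σ t → σ x ≡ c → FinX c E t →
                (∀ σ' → E σ' → ¬ σ' x ≡ c) → Follows Q τb u →
                Σ Trace λ τ → (out u ▷ₛ τ) × Q τ × E (hd τ)
crossing-from {E = E} {σ = σ} e hσ (fend e' ee) leaves f with follows-cons f e
... | u₁ , eu , f₁ with follows-end f₁ e'
... | hu₁ , q = u₁ , subst (_▷ₛ u₁) (sym eu) (diff changes ≈-refl) , q , subst E (sym hu₁) ee
  where
  changes : ¬ σ x ≡ hd u₁ x
  changes eq = leaves _ ee (trans (cong xOf (sym hu₁)) (trans (sym eq) hσ))
crossing-from {σ = σ} {t = t} e hσ (fcons e' hσ' rest) leaves f with follows-cons f e
... | u₁ , eu , f₁ with crossing-from e' hσ' rest leaves f₁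
... | τ , cross , q , eτ = τ , subst (_▷ₛ τ) (sym eu) (same stays cross) , q , eτ
  where
  stays : σ x ≡ hd u₁ x
  stays = trans hσ (sym (trans (cong xOf (trans (follows-hd f₁) (out-cons-hd t e'))) hσ'))

crossing : ∀ {q} {Q : TPred q} {c E τb u} → FinX c E τb → hd τb x ≡ c → (∀ σ → E σ → ¬ σ x ≡ c) →
           Follows Q τb u → Σ Trace λ τ → (out u ▷ₛ τ) × Q τ × E (hd τ)
crossing {τb = τb} (fend e ee) hx leaves f =
  ⊥-elim (leaves _ ee (trans (cong xOf (sym (out-end-hd τb e))) hx))
crossing (fcons e hσ rest) _ leaves f = crossing-from e hσ rest leaves f

guardY : BExp
guardY = var y ≠ lit (+ 0)

decrY : AExp
decrY = var y ⊖ lit (+ 1)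

incX : AExp
incX = var x ⊕ lit (+ 1)

countdown : Stmt
countdown = while guardY loop (y ≔ decrY)

body : Stmt
body = (y ≔ var x) ︔ (countdown ︔ (x ≔ incX))

XIs : ℕ → SPred
XIs n σ = σ x ≡ + n

XYIs : ℕ → SPred
XYIs n σ = σ x ≡ + n × σ y ≡ + n

XNat : SPred
XNat σ = Σ ℕ λ m → σ x ≡ + m

Incremented : ℕ → SPred
Incremented n σ = σ x ≡ + suc n

Block : ℕ → TPred 0ℓ
Block n τ = FinX (+ n) (Incremented n) τ × hd τ x ≡ + n

SomeBlock : TPred 0ℓ
SomeBlock τ = Σ ℕ λ n → Block n τ

block-setoid : ∀ {n} → IsSetoid (Block n)
block-setoid {n} {τ} {τ'} p (f , h) = finx-setoid p f , trans (cong xOf (sym (≈-hd {τ} {τ'} p))) h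

Countdown : ℕ → TPred (lsuc 0ℓ)
Countdown n = Assign (guardY ∧ˢ XIs n) y decrY ** Dup (XIs n)

guard-zero : ∀ σ → σ y ≡ + 0 → ¬ (σ ⊨ guardY)
guard-zero σ hy holds = subst (λ v → T (not ⌊ v ℤP.≟ + 0 ⌋)) hy holds

module InnerLoop (n : ℕ) {D : TPred (lsuc 0ℓ)} (unroll : ∀ t → D t → DaggerF (Countdown n) D t) where

  Rest : TPred (lsuc 0ℓ)
  Rest = D ** Ret ⌜¬ guardY ⌝

  data Unfolding (u : Trace) : Set₁ where
    exited   : ∀ {σ} → out u ≡ end σ → Unfolding u
    iterated : ∀ {σ u₁ u₂} → out u ≡ cons σ u₁ → out u₁ ≡ cons (hd u₂) u₂ → σ ⊨ guardY →
               hd u₂ ≡ σ [ y ↦ ⟦ decrY ⟧ σ ] → Rest u₂ → Unfolding u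

  unfold : ∀ u → Rest u → Unfolding u
  unfold u l with loop-unfold unroll u l
  ... | inj₁ r with ret-inv u r
  ...   | _ , e , _ = exited e
  unfold u l | inj₂ (τa , pa , f) with assign-inv τa pa
  ... | σ , τa' , ea , ea' , (guard , _) with follows-cons f ea
  ... | u₁ , e₁ , f₁ with follows-end f₁ ea'
  ... | hu₁ , rest with dup-head u₁ rest
  ... | u₂ , e₂ , _ , l₂ = iterated e₁ e₂ guard (trans (sym (out-cons-hd u₁ e₂)) hu₁) l₂

  terminates : ∀ k u → Rest u → hd u x ≡ + n → hd u y ≡ + k → FinX (+ n) (XIs n) u
  terminates k u l hx hy with unfold u l
  ... | exited e = fend e (subst (XIs n) (out-end-hd u e) hx)
  ... | iterated {σ} {u₂ = u₂} e₁ e₂ guard h l₂ = decrement k hσy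
    where
    hσ : hd u ≡ σ
    hσ = out-cons-hd u e₁
    hσx : σ x ≡ + n
    hσx = trans (cong xOf (sym hσ)) hx
    hσy : σ y ≡ + k
    hσy = trans (cong (λ s → s y) (sym hσ)) hy
    decrement : ∀ k → σ y ≡ + k → FinX (+ n) (XIs n) u
    decrement zero hz = ⊥-elim (guard-zero σ hz guard)
    decrement (suc k') hs = fcons e₁ hσx (fcons e₂ hx₂ (terminates k' u₂ l₂ hx₂ hy₂))
      where
      hx₂ : hd u₂ x ≡ + n
      hx₂ = trans (cong xOf h) hσx
      hy₂ : hd u₂ y ≡ + k'
      hy₂ = trans (cong (λ s → s y) h) (cong (_-ℤ + 1) hs)

countdown-finite : ∀ n τ → (Dup (XYIs n) ** ((Countdown n †) ** Ret ⌜¬ guardY ⌝)) τ → FinX (+ n) (XIs n) τ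
countdown-finite n τ p with dup-head τ p
... | τ' , e , (hx , hy) , rest with dagger-witness rest
... | D , unroll , l = fcons e hx (InnerLoop.terminates n unroll n τ' l hx hy)

module Body (n : ℕ) where

  copyX : ⊢⟦ XIs n ⟧ y ≔ var x ⟦ Assign (XIs n) y (var x) ** Ret (XYIs n) ⟧
  copyX = conseq-rule (**-setoid ret-setoid) assign-setoid (λ σ u → u) assign-rule
            (assign-ret (λ σ u → u) (λ σ u → u , u))

  decrement : ⊢⟦ guardY ∧ˢ XIs n ⟧ y ≔ decrY ⟦ Assign (guardY ∧ˢ XIs n) y decrY ** Ret (XIs n) ⟧
  decrement = conseq-rule (**-setoid ret-setoid) assign-setoid (λ σ u → u) assign-rule
                (assign-ret (λ σ u → proj₂ u) (λ σ u → proj₂ u))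

  countdown-rule : ⊢⟦ XYIs n ⟧ countdown ⟦ FinX (+ n) (XIs n) ** Ret (XIs n) ⟧
  countdown-rule = conseq-rule (**-setoid ret-setoid) (**-setoid (**-setoid ret-setoid)) (λ σ u → u)
                     (while-rule assign-setoid (λ σ u → proj₁ u) decrement)
                     (λ τ p → τ , countdown-finite n τ p , finx-ret (countdown-finite n τ p) (λ σ u → u))

  sequence : ⊢⟦ XIs n ⟧ body ⟦ Assign (XIs n) y (var x) ** (FinX (+ n) (XIs n) ** Assign (XIs n) x incX) ⟧
  sequence = seq-rule assign-setoid (**-setoid assign-setoid) copyX
               (seq-rule finx-setoid assign-setoid countdown-rule assign-rule)

  increment : ∀ σ → XIs n σ → Incremented n (σ [ x ↦ ⟦ incX ⟧ σ ])
  increment σ hx = trans (cong (_+ℤ + 1) hx) (cong +_ (ℕP.+-comm n 1))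

  is-block : ∀ τ → (Assign (XIs n) y (var x) ** (FinX (+ n) (XIs n) ** Assign (XIs n) x incX)) τ → Block n τ
  is-block τ (τa , pa , f) with assign-inv τa pa
  ... | _ , _ , ea , _ , hx =
    finx-follows (assign→finx {E = XIs n} (λ σ u → u) (λ σ u → u) pa) f after-copy ,
    trans (cong xOf (trans (follows-hd f) (out-cons-hd τa ea))) hx
    where
    after-copy : ∀ u → (FinX (+ n) (XIs n) ** Assign (XIs n) x incX) u → XIs n (hd u) → FinX (+ n) (Incremented n) u
    after-copy u (τc , fc , fu) _ =
      finx-follows fc fu (λ v a _ → assign→finx (λ σ h → h) increment a)

  rule : ⊢⟦ XIs n ⟧ body ⟦ Block n ** Ret XNat ⟧
  rule = conseq-rule (**-setoid ret-setoid) (**-setoid (**-setoid assign-setoid)) (λ σ u → u) sequence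
           (λ τ p → τ , is-block τ p , finx-ret (proj₁ (is-block τ p)) (λ σ u → suc n , u))

outer-body : ⊢⟦ btrue ∧ˢ XNat ⟧ body ⟦ SomeBlock ** Ret XNat ⟧
outer-body = conseq-rule (**-setoid ret-setoid) (∃-setoid (λ n → **-setoid ret-setoid)) (λ σ u → proj₂ u)
               (exists-rule {U = XIs} {P = λ n → Block n ** Ret XNat} (λ n → **-setoid ret-setoid) Body.rule)
               (λ τ (n , τ₀ , b , f) → τ₀ , (n , b) , f)

outer-loop : ⊢⟦ x≡0 ⟧ prog ⟦ Dup x≡0 ** ((SomeBlock ** Dup XNat) † ** Ret ⌜¬ btrue ⌝) ⟧
outer-loop = while-rule (∃-setoid (λ n → block-setoid)) (λ σ h → 0 , h) outer-body

leaves-n : ∀ n σ → Incremented n σ → ¬ σ x ≡ + n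
leaves-n n σ inc eq = ℕP.1+n≢n (ℤP.+-injective (trans (sym inc) eq))

module OuterLoop {D : TPred (lsuc 0ℓ)} (unroll : ∀ t → D t → DaggerF (SomeBlock ** Dup XNat) D t) where

  Loop : ℕ → Trace → Set₁
  Loop n u = (D ** Ret ⌜¬ btrue ⌝) u × hd u x ≡ + n

  Seam : ℕ → Trace → Set₁
  Seam n t = Σ Trace λ u → out t ≡ cons (hd u) u × Loop n u

  -- The loop never exits, so an iteration crosses a block and reaches the next seam.
  loop-crosses : ∀ n u → Loop n u → Σ Trace λ τ → (out u ▷ₛ τ) × Seam (suc n) τ
  loop-crosses n u (l , hx) with loop-unfold unroll u l
  ... | inj₁ r = ⊥-elim (proj₂ (proj₂ (ret-inv u r)) tt)
  ... | inj₂ (τb , (m , block , hb) , f) with ℤP.+-injective (trans (sym hb) (trans (cong xOf (sym (follows-hd f))) hx))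
  ... | refl with crossing block hb (leaves-n n) f
  ... | τ , cross , rest , hτ with dup-head τ rest
  ... | u' , e , _ , l' = τ , cross , u' , e , l' , trans (cong xOf (sym (out-cons-hd τ e))) hτ

  seam-crosses : ∀ n t → Seam n t → hd t x ≡ + n × Σ Trace λ τ → (out t ▷ₛ τ) × Seam (suc n) τ
  seam-crosses n t (u , e , loop@(_ , hx)) with loop-crosses n u loop
  ... | τ , cross , s = trans (cong xOf (out-cons-hd t e)) hx , τ , subst (_▷ₛ τ) (sym e) (same refl cross) , s

  seam-up : ∀ {n t} → Seam n t → up n t
  seam-up = up-coind Seam seam-crosses

outer-up : ∀ τ → (Dup x≡0 ** ((SomeBlock ** Dup XNat) † ** Ret ⌜¬ btrue ⌝)) τ → up 0 τ
outer-up τ p with dup-head τ p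
... | τ' , e , h0 , rest with dagger-witness rest
... | D , unroll , l = OuterLoop.seam-up unroll (τ' , e , l , h0)

proposition5p6 : ⊢⟦ x≡0 ⟧ prog ⟦ up 0 ⟧
proposition5p6 = conseq-rule up-setoid (**-setoid (**-setoid ret-setoid)) (λ σ u → u) outer-loop outer-up
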